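{- Let $G$ be a finite simple undirected graph, let $w\in\mathbb{R}^{V(G)}$ with $w\ge 0$, and let $\delta>1$. Then $\alpha_w(G)=\max\{w^\top x : x \text{ solves } \mathrm{LCP}_\delta(G)\}$.
   Context: For a graph $G$ with adjacency matrix $A$ and $\delta>0$, $\mathrm{LCP}_\delta(G)$ is the problem: find $x\in\mathbb{R}^{V(G)}$ with $x\ge0$, $(I+\delta A)x-\mathbf{e}\ge 0$, $x^\top((I+\delta A)x-\mathbf{e})=0$ ($\mathbf{e}$ the all-ones vector). The $w$-weighted independence number is $\alpha_w(G)=\max\{\sum_{i\in S}w_i : S\subset V(G)\text{ independent}\}$. -}

module Defs where

open import Level using (Level; _⊔_; suc)
open import Data.Bool using (Bool; true; false; if_then_else_)
open import Data.Nat using (ℕ; zero) renaming (suc to sucℕ)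
open import Data.Fin using (Fin) renaming (zero to fzero; suc to fsuc)
open import Data.Product using (Σ; _×_; ∃)
open import Relation.Nullary using (¬_)
open import Relation.Binary.PropositionalEquality using (_≡_)
open import Algebra.Structures using (IsCommutativeRing)
open import Relation.Binary.Structures using (IsTotalOrder)

-- Ordered fields (ℝ is one; the real numbers are not in agda-stdlib).

record OrderedField (c ℓ₁ ℓ₂ : Level) : Set (suc (c ⊔ ℓ₁ ⊔ ℓ₂)) where
  infix  4 _≈_ _≤_ _<_
  infixl 7 _*_
  infixl 6 _+_
  field
    Carrier : Set c
    _≈_     : Carrier → Carrier → Set ℓ₁
    _≤_     : Carrier → Carrier → Set ℓ₂
    _+_     : Carrier → Carrier → Carrier
    _*_     : Carrier → Carrier → Carrier
    -_      : Carrier → Carrier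
    0#      : Carrier
    1#      : Carrier
    isCommutativeRing : IsCommutativeRing _≈_ _+_ _*_ -_ 0# 1#
    isTotalOrder      : IsTotalOrder _≈_ _≤_
    0≉1               : ¬ (0# ≈ 1#)
    inverse           : ∀ x → ¬ (x ≈ 0#) → ∃ λ y → x * y ≈ 1#
    +-mono-≤          : ∀ {x y} z → x ≤ y → x + z ≤ y + z
    *-nonneg          : ∀ {x y} → 0# ≤ x → 0# ≤ y → 0# ≤ x * y

  _<_ : Carrier → Carrier → Set (ℓ₁ ⊔ ℓ₂)
  x < y = (x ≤ y) × ¬ (x ≈ y)

  _-_ : Carrier → Carrier → Carrier
  x - y = x + (- y)

record Graph (n : ℕ) : Set where
  field
    adj     : Fin n → Fin n → Bool
    symm    : ∀ i j → adj i j ≡ adj j i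
    irrefl  : ∀ i → adj i i ≡ false

Independent : ∀ {n} → Graph n → (Fin n → Bool) → Set
Independent G S = ∀ i j → S i ≡ true → S j ≡ true → Graph.adj G i j ≡ false

module _ {c ℓ₁ ℓ₂} (F : OrderedField c ℓ₁ ℓ₂) where
  open OrderedField F

  sumF : ∀ {n} → (Fin n → Carrier) → Carrier
  sumF {zero}   f = 0#
  sumF {sucℕ n} f = f fzero + sumF (λ i → f (fsuc i))

  adjMat : ∀ {n} → Graph n → Fin n → Fin n → Carrier
  adjMat G i j = if Graph.adj G i j then 1# else 0#

  lcpResidual : ∀ {n} → Graph n → Carrier → (Fin n → Carrier) → Fin n → Carrier
  lcpResidual G δ x i = (x i + δ * sumF (λ j → adjMat G i j * x j)) - 1#

  SolvesLCP : ∀ {n} → Graph n → Carrier → (Fin n → Carrier) → Set (ℓ₁ ⊔ ℓ₂)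
  SolvesLCP G δ x =
    (∀ i → 0# ≤ x i) ×
    (∀ i → 0# ≤ lcpResidual G δ x i) ×
    (sumF (λ i → x i * lcpResidual G δ x i) ≈ 0#)

  dot : ∀ {n} → (Fin n → Carrier) → (Fin n → Carrier) → Carrier
  dot w x = sumF (λ i → w i * x i)

  weightOf : ∀ {n} → (Fin n → Carrier) → (Fin n → Bool) → Carrier
  weightOf w S = sumF (λ i → if S i then w i else 0#)

  IsMaximum : ∀ {a p} {A : Set a} → (A → Set p) → (A → Carrier) → Carrier → Set _
  IsMaximum {A = A} P f m = (Σ A λ z → P z × (f z ≈ m)) × (∀ z → P z → f z ≤ m)

  IsAlpha : ∀ {n} → Graph n → (Fin n → Carrier) → Carrier → Set _
  IsAlpha G w a = IsMaximum (Independent G) (weightOf w) a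

-- If x solves LCP_δ(G) with δ > 1, complementarity at a vertex u forces x_u = 0 or
-- x_u + Σ_{j∼u} x_j ≤ 1. Round x greedily, always at a remaining vertex u of largest
-- weight: either u is discarded (x_u = 0), or u joins the independent set and its
-- neighbours are discarded, their contribution Σ_{j∼u} w_j x_j being at most
-- w_u Σ_{j∼u} x_j ≤ w_u (1 - x_u). Hence wᵀx ≤ α_w(G). Conversely, the indicator vector of
-- a maximal independent set solves LCP_δ(G) for every δ ≥ 1, and as w ≥ 0 a maximum-weight
-- independent set extends to a maximal one of the same weight, so α_w(G) is attained.

module Submission where

open import Defs
open import Algebra.Bundles using (CommutativeRing)
open import Data.Integer as ℤ using (ℤ; +_; -[1+_]; _⊖_)
import Data.Integer.Properties as ℤₚ
open import Data.Bool as Bool using (Bool; true; false; not; _∧_; _∨_; if_then_else_)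
open import Data.Bool.Properties using (∧-zeroʳ; ∨-zeroʳ; ¬-not)
open import Data.Fin using (Fin) renaming (zero to fzero; suc to fsuc)
open import Data.Fin.Properties using (_≟_; any?; all?)
open import Data.List using (List; []; _∷_; _++_; map; filter; allFin)
open import Data.List.Membership.Propositional using () renaming (_∈_ to _∈ₗ_)
open import Data.List.Membership.Propositional.Properties using (∈-filter⁺; ∈-allFin; ∈-map⁺; ∈-++⁺ˡ; ∈-++⁺ʳ)
open import Data.List.Relation.Unary.All as All using (_∷_)
open import Data.List.Relation.Unary.All.Properties using (all-filter)
open import Data.List.Relation.Unary.Any using (here; there)
open import Data.List.Relation.Unary.Any.Properties using (¬Any[])
open import Data.Empty using (⊥-elim)
open import Data.Maybe using (Maybe; just; nothing)
open import Data.Product using (Σ; _×_; _,_; proj₁; proj₂)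
open import Data.Sum using (_⊎_; inj₁; inj₂; [_,_]′)
open import Data.Nat as ℕ using (ℕ; zero; suc; z≤n; s≤s)
open import Data.Nat.Induction using (<-wellFounded)
open import Induction.WellFounded using (Acc; acc)
import Data.Nat.Properties as ℕₚ
open import Data.Sign as Sign using (Sign)
open import Relation.Nullary using (¬_; Dec; yes; no; does; ¬?; _×-dec_; _→-dec_)
open import Relation.Nullary.Decidable using (dec-true)
import Data.Vec.Functional as Vec
open Vec using (tail)
open import Relation.Binary.Bundles using (TotalOrder)
open import Relation.Unary using (Decidable)
import Relation.Binary.Reasoning.PartialOrder as PartialOrderReasoning
import Relation.Binary.Reasoning.Setoid as SetoidReasoning
open import Relation.Binary.PropositionalEquality as ≡ using (_≡_; _≗_)

-- Algebra.Solver.Ring needs coefficients whose equality it can decide; ℤ, interpreted by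
-- n ↦ n · 1#, works in every commutative ring. The TCOptimised multiple makes the
-- constants 0 and 1 of solver expressions denote 0# and 1# definitionally.
module IntegerCoefficientSolver {c ℓ} (R : CommutativeRing c ℓ) where
  open CommutativeRing R
  open import Algebra.Properties.Semiring.Mult.TCOptimised semiring using (×-homo-+; ×1-homo-*; 1+×) renaming (_×_ to _·_)
  open import Algebra.Properties.Ring ring using (-‿distribˡ-*; -‿distribʳ-*)
  open import Algebra.Properties.Group +-group using (ε⁻¹≈ε; ⁻¹-involutive)
  open import Algebra.Properties.AbelianGroup +-abelianGroup using (⁻¹-∙-comm)
  open import Algebra.Properties.CommutativeSemigroup +-commutativeSemigroup using (interchange)
  open import Algebra.Solver.Ring.AlmostCommutativeRing using (fromCommutativeRing; _-Raw-AlmostCommutative⟶_)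
  import Algebra.Solver.Ring as RingSolver
  open SetoidReasoning setoid

  ⟦_⟧ : ℤ → Carrier
  ⟦ + n ⟧      = n · 1#
  ⟦ -[1+ n ] ⟧ = - (suc n · 1#)

  ⊖-homo : ∀ m n → ⟦ m ⊖ n ⟧ ≈ m · 1# - n · 1#
  ⊖-homo zero    zero    = sym (trans (+-congˡ ε⁻¹≈ε) (+-identityʳ 0#))
  ⊖-homo (suc m) zero    = sym (trans (+-congˡ ε⁻¹≈ε) (+-identityʳ _))
  ⊖-homo zero    (suc n) = sym (+-identityˡ _)
  ⊖-homo (suc m) (suc n) = begin
    ⟦ suc m ⊖ suc n ⟧                       ≡⟨ ≡.cong ⟦_⟧ (ℤₚ.[1+m]⊖[1+n]≡m⊖n m n) ⟩
    ⟦ m ⊖ n ⟧                               ≈⟨ ⊖-homo m n ⟩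
    m · 1# - n · 1#                         ≈⟨ +-identityˡ _ ⟨
    0# + (m · 1# - n · 1#)                  ≈⟨ +-congʳ (-‿inverseʳ 1#) ⟨
    (1# - 1#) + (m · 1# - n · 1#)           ≈⟨ interchange 1# (- 1#) (m · 1#) (- (n · 1#)) ⟩
    (1# + m · 1#) + (- 1# - n · 1#)         ≈⟨ +-congˡ (⁻¹-∙-comm 1# (n · 1#)) ⟩
    (1# + m · 1#) - (1# + n · 1#)           ≈⟨ +-cong (1+× m 1#) (-‿cong (1+× n 1#)) ⟨
    suc m · 1# - suc n · 1#                 ∎

  +-homo : ∀ i j → ⟦ i ℤ.+ j ⟧ ≈ ⟦ i ⟧ + ⟦ j ⟧
  +-homo (+ m)    (+ n)    = ×-homo-+ 1# m n
  +-homo (+ m)    -[1+ n ] = ⊖-homo m (suc n)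
  +-homo -[1+ m ] (+ n)    = trans (⊖-homo n (suc m)) (+-comm _ _)
  +-homo -[1+ m ] -[1+ n ] = begin
    - (suc (suc (m ℕ.+ n)) · 1#)   ≡⟨ ≡.cong (λ k → - (suc k · 1#)) (ℕₚ.+-suc m n) ⟨
    - ((suc m ℕ.+ suc n) · 1#)     ≈⟨ -‿cong (×-homo-+ 1# (suc m) (suc n)) ⟩
    - (suc m · 1# + suc n · 1#)    ≈⟨ ⁻¹-∙-comm _ _ ⟨
    - (suc m · 1#) - (suc n · 1#)  ∎

  signed : Sign → Carrier → Carrier
  signed Sign.+ x = x
  signed Sign.- x = - x

  signed-cong : ∀ s {x y} → x ≈ y → signed s x ≈ signed s y
  signed-cong Sign.+ x≈y = x≈y
  signed-cong Sign.- x≈y = -‿cong x≈y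

  signed-* : ∀ s t x y → signed (s Sign.* t) (x * y) ≈ signed s x * signed t y
  signed-* Sign.+ Sign.+ x y = refl
  signed-* Sign.+ Sign.- x y = -‿distribʳ-* x y
  signed-* Sign.- Sign.+ x y = -‿distribˡ-* x y
  signed-* Sign.- Sign.- x y = begin
    x * y         ≈⟨ ⁻¹-involutive _ ⟨
    - - (x * y)   ≈⟨ -‿cong (-‿distribʳ-* x y) ⟩
    - (x * - y)   ≈⟨ -‿distribˡ-* x (- y) ⟩
    - x * - y     ∎

  ◃-homo : ∀ s n → ⟦ s ℤ.◃ n ⟧ ≈ signed s (n · 1#)
  ◃-homo Sign.+ zero    = refl
  ◃-homo Sign.- zero    = sym ε⁻¹≈ε
  ◃-homo Sign.+ (suc n) = refl
  ◃-homo Sign.- (suc n) = refl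

  ⟦⟧-sign-abs : ∀ i → ⟦ i ⟧ ≈ signed (ℤ.sign i) (ℤ.∣ i ∣ · 1#)
  ⟦⟧-sign-abs (+ n)    = refl
  ⟦⟧-sign-abs -[1+ n ] = refl

  *-homo : ∀ i j → ⟦ i ℤ.* j ⟧ ≈ ⟦ i ⟧ * ⟦ j ⟧
  *-homo i j = begin
    ⟦ i ℤ.* j ⟧                                            ≈⟨ ◃-homo s (ℤ.∣ i ∣ ℕ.* ℤ.∣ j ∣) ⟩
    signed s ((ℤ.∣ i ∣ ℕ.* ℤ.∣ j ∣) · 1#)                  ≈⟨ signed-cong s (×1-homo-* ℤ.∣ i ∣ ℤ.∣ j ∣) ⟩
    signed s (ℤ.∣ i ∣ · 1# * ℤ.∣ j ∣ · 1#)                 ≈⟨ signed-* (ℤ.sign i) (ℤ.sign j) _ _ ⟩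
    signed (ℤ.sign i) (ℤ.∣ i ∣ · 1#) * signed (ℤ.sign j) (ℤ.∣ j ∣ · 1#) ≈⟨ *-cong (⟦⟧-sign-abs i) (⟦⟧-sign-abs j) ⟨
    ⟦ i ⟧ * ⟦ j ⟧                                          ∎
    where s = ℤ.sign i Sign.* ℤ.sign j

  -‿homo : ∀ i → ⟦ ℤ.- i ⟧ ≈ - ⟦ i ⟧
  -‿homo (+ zero)    = sym ε⁻¹≈ε
  -‿homo (+ suc n)   = refl
  -‿homo -[1+ n ]    = sym (⁻¹-involutive _)

  ⟦⟧-homomorphism : CommutativeRing.rawRing ℤₚ.+-*-commutativeRing -Raw-AlmostCommutative⟶ fromCommutativeRing R
  ⟦⟧-homomorphism = record
    { ⟦_⟧    = ⟦_⟧
    ; +-homo = +-homo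
    ; *-homo = *-homo
    ; -‿homo = -‿homo
    ; 0-homo = refl
    ; 1-homo = refl
    }

  ⟦⟧-equal? : ∀ i j → Maybe (⟦ i ⟧ ≈ ⟦ j ⟧)
  ⟦⟧-equal? i j with i ℤ.≟ j
  ... | yes ≡.refl = just refl
  ... | no _       = nothing

  open RingSolver (CommutativeRing.rawRing ℤₚ.+-*-commutativeRing) (fromCommutativeRing R) ⟦⟧-homomorphism ⟦⟧-equal? public
    using (solve; _:=_; _:+_; _:*_; _:-_; :-_; con)

-- Defs gives _-_ no fixity, so it binds tighter than _+_ and _*_; hence the parentheses
-- around the arguments of every subtraction below.
module OrderedFieldProperties {c ℓ₁ ℓ₂} (F : OrderedField c ℓ₁ ℓ₂) where
  open OrderedField F public renaming (+-mono-≤ to +-monoˡ-≤)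

  commutativeRing : CommutativeRing c ℓ₁
  commutativeRing = record { isCommutativeRing = isCommutativeRing }

  open CommutativeRing commutativeRing public
    using ( setoid; +-cong; +-congˡ; +-congʳ; *-congˡ; *-congʳ; -‿cong
          ; +-identityˡ; +-identityʳ; *-identityˡ; *-identityʳ; zeroˡ; zeroʳ; +-comm; *-comm; -‿inverseʳ; distribˡ )
    renaming (refl to ≈-refl; sym to ≈-sym; trans to ≈-trans; reflexive to ≡⇒≈)

  totalOrder : TotalOrder c ℓ₁ ℓ₂
  totalOrder = record { isTotalOrder = isTotalOrder }

  open TotalOrder totalOrder public
    using (poset; total; antisym; ≤-respˡ-≈; ≤-respʳ-≈)
    renaming (refl to ≤-refl; trans to ≤-trans; reflexive to ≈⇒≤)

  open IntegerCoefficientSolver commutativeRing public using (solve; _:=_; _:+_; _:*_; _:-_; :-_; con)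
  open import Algebra.Properties.Group (CommutativeRing.+-group commutativeRing) using (x∙y⁻¹≈ε⇒x≈y)

  module ≤-Reasoning = PartialOrderReasoning poset
  module ≈-Reasoning = SetoidReasoning setoid

  +-monoʳ-≤ : ∀ z {x y} → x ≤ y → z + x ≤ z + y
  +-monoʳ-≤ z {x} {y} x≤y = begin
    z + x  ≈⟨ +-comm z x ⟩
    x + z  ≤⟨ +-monoˡ-≤ z x≤y ⟩
    y + z  ≈⟨ +-comm y z ⟩
    z + y  ∎
    where open ≤-Reasoning

  +-mono-≤ : ∀ {x y u v} → x ≤ y → u ≤ v → x + u ≤ y + v
  +-mono-≤ {y = y} {u} x≤y u≤v = ≤-trans (+-monoˡ-≤ u x≤y) (+-monoʳ-≤ y u≤v)

  +-cancelʳ-≤ : ∀ z {x y} → x + z ≤ y + z → x ≤ y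
  +-cancelʳ-≤ z {x} {y} le = begin
    x                ≈⟨ solve 2 (λ x z → x := (x :+ z) :- z) ≈-refl x z ⟩
    (x + z) - z      ≤⟨ +-monoˡ-≤ (- z) le ⟩
    (y + z) - z      ≈⟨ solve 2 (λ y z → (y :+ z) :- z := y) ≈-refl y z ⟩
    y                ∎
    where open ≤-Reasoning

  x≤y⇒0≤y-x : ∀ {x y} → x ≤ y → 0# ≤ y - x
  x≤y⇒0≤y-x {x} {y} x≤y = +-cancelʳ-≤ x (begin
    0# + x         ≈⟨ solve 2 (λ x y → con (+ 0) :+ x := x) ≈-refl x y ⟩
    x              ≤⟨ x≤y ⟩
    y              ≈⟨ solve 2 (λ x y → y := (y :- x) :+ x) ≈-refl x y ⟩
    (y - x) + x    ∎)
    where open ≤-Reasoning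

  *-monoʳ-≤-nonneg : ∀ {z x y} → 0# ≤ z → x ≤ y → z * x ≤ z * y
  *-monoʳ-≤-nonneg {z} {x} {y} 0≤z x≤y = +-cancelʳ-≤ (- (z * x)) (begin
    (z * x) - (z * x)  ≈⟨ solve 2 (λ z x → z :* x :- z :* x := con (+ 0)) ≈-refl z x ⟩
    0#                 ≤⟨ *-nonneg 0≤z (x≤y⇒0≤y-x x≤y) ⟩
    z * (y - x)        ≈⟨ solve 3 (λ z x y → z :* (y :- x) := z :* y :- z :* x) ≈-refl z x y ⟩
    (z * y) - (z * x)  ∎)
    where open ≤-Reasoning

  *-monoˡ-≤-nonneg : ∀ {z x y} → 0# ≤ z → x ≤ y → x * z ≤ y * z
  *-monoˡ-≤-nonneg {z} {x} {y} 0≤z x≤y = begin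
    x * z  ≈⟨ *-comm x z ⟩
    z * x  ≤⟨ *-monoʳ-≤-nonneg 0≤z x≤y ⟩
    z * y  ≈⟨ *-comm z y ⟩
    y * z  ∎
    where open ≤-Reasoning

  0≤x*x : ∀ x → 0# ≤ x * x
  0≤x*x x with total 0# x
  ... | inj₁ 0≤x = *-nonneg 0≤x 0≤x
  ... | inj₂ x≤0 = begin
    0#          ≤⟨ *-nonneg 0≤-x 0≤-x ⟩
    - x * - x   ≈⟨ solve 1 (λ x → :- x :* :- x := x :* x) ≈-refl x ⟩
    x * x       ∎
    where
    open ≤-Reasoning
    0≤-x : 0# ≤ - x
    0≤-x = ≤-respʳ-≈ (+-identityˡ (- x)) (x≤y⇒0≤y-x x≤0)

  0≤1 : 0# ≤ 1#
  0≤1 = ≤-respʳ-≈ (*-identityˡ 1#) (0≤x*x 1#)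

  x*y≈0⇒y≈0 : ∀ {x y} → ¬ (x ≈ 0#) → x * y ≈ 0# → y ≈ 0#
  x*y≈0⇒y≈0 {x} {y} x≉0 xy≈0 with inverse x x≉0
  ... | x⁻¹ , xx⁻¹≈1 = begin
    y                ≈⟨ *-identityˡ y ⟨
    1# * y           ≈⟨ *-congʳ xx⁻¹≈1 ⟨
    (x * x⁻¹) * y    ≈⟨ solve 3 (λ x x⁻¹ y → (x :* x⁻¹) :* y := x⁻¹ :* (x :* y)) ≈-refl x x⁻¹ y ⟩
    x⁻¹ * (x * y)    ≈⟨ *-congˡ xy≈0 ⟩
    x⁻¹ * 0#         ≈⟨ zeroʳ x⁻¹ ⟩
    0#               ∎
    where open ≈-Reasoning

  idempotent⇒0≤ : ∀ {x} → x * x ≈ x → 0# ≤ x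
  idempotent⇒0≤ {x} xx≈x = ≤-respʳ-≈ xx≈x (0≤x*x x)

  idempotent⇒x[1-x]≈0 : ∀ {x} → x * x ≈ x → x * (1# - x) ≈ 0#
  idempotent⇒x[1-x]≈0 {x} xx≈x = begin
    x * (1# - x)   ≈⟨ solve 1 (λ x → x :* (con (+ 1) :- x) := x :- x :* x) ≈-refl x ⟩
    x - (x * x)    ≈⟨ +-congˡ (-‿cong xx≈x) ⟩
    x - x          ≈⟨ -‿inverseʳ x ⟩
    0#             ∎
    where open ≈-Reasoning

  idempotent⇒1-x-idempotent : ∀ {x} → x * x ≈ x → (1# - x) * (1# - x) ≈ 1# - x
  idempotent⇒1-x-idempotent {x} xx≈x = begin
    (1# - x) * (1# - x)
      ≈⟨ solve 1 (λ x → (con (+ 1) :- x) :* (con (+ 1) :- x) := (con (+ 1) :- x) :- x :* (con (+ 1) :- x)) ≈-refl x ⟩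
    (1# - x) - (x * (1# - x))  ≈⟨ +-congˡ (-‿cong (idempotent⇒x[1-x]≈0 xx≈x)) ⟩
    (1# - x) - 0#              ≈⟨ solve 1 (λ x → (con (+ 1) :- x) :- con (+ 0) := con (+ 1) :- x) ≈-refl x ⟩
    1# - x                     ∎
    where open ≈-Reasoning

  idempotent-≤⇒≈0 : ∀ {x y} → x * x ≈ x → x ≤ y → x * y ≈ 0# → x ≈ 0#
  idempotent-≤⇒≈0 {x} {y} xx≈x x≤y xy≈0 = antisym x≤0 (idempotent⇒0≤ xx≈x)
    where
    open ≤-Reasoning
    x≤0 : x ≤ 0#
    x≤0 = begin
      x      ≈⟨ xx≈x ⟨
      x * x  ≤⟨ *-monoʳ-≤-nonneg (idempotent⇒0≤ xx≈x) x≤y ⟩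
      x * y  ≈⟨ xy≈0 ⟩
      0#     ∎

  idempotent⇒≈0⊎≈1 : ∀ {x} → x * x ≈ x → x ≈ 0# ⊎ x ≈ 1#
  idempotent⇒≈0⊎≈1 {x} xx≈x with total x (1# - x)
  ... | inj₁ x≤1-x = inj₁ (idempotent-≤⇒≈0 xx≈x x≤1-x (idempotent⇒x[1-x]≈0 xx≈x))
  ... | inj₂ 1-x≤x = inj₂ (≈-sym (x∙y⁻¹≈ε⇒x≈y 1# x 1-x≈0))
    where
    1-x≈0 : 1# - x ≈ 0#
    1-x≈0 = idempotent-≤⇒≈0 (idempotent⇒1-x-idempotent xx≈x) 1-x≤x
              (≈-trans (*-comm (1# - x) x) (idempotent⇒x[1-x]≈0 xx≈x))

  -- Put r = a + δ s - 1 and t = (δ - 1) s. If r ≤ t then a + s ≤ 1 at once; otherwise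
  -- 0 ≤ a t ≤ a r = 0 gives a s = 0, so a is idempotent, i.e. 0 or 1.
  module _ {δ a s : Carrier} (1<δ : 1# < δ) (0≤a : 0# ≤ a) (0≤s : 0# ≤ s)
           (ar≈0 : a * ((a + δ * s) - 1#) ≈ 0#) where

    private
      r t : Carrier
      r = (a + δ * s) - 1#
      t = (δ - 1#) * s

      r≤t⇒a+s≤1 : r ≤ t → a + s ≤ 1#
      r≤t⇒a+s≤1 r≤t = +-cancelʳ-≤ t (begin
        (a + s) + t
          ≈⟨ solve 3 (λ δ a s → (a :+ s) :+ (δ :- con (+ 1)) :* s := ((a :+ δ :* s) :- con (+ 1)) :+ con (+ 1)) ≈-refl δ a s ⟩
        r + 1#       ≤⟨ +-monoˡ-≤ 1# r≤t ⟩
        t + 1#       ≈⟨ +-comm t 1# ⟩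
        1# + t       ∎)
        where open ≤-Reasoning

      δ-1≉0 : ¬ (δ - 1# ≈ 0#)
      δ-1≉0 δ-1≈0 = proj₂ 1<δ (≈-sym (x∙y⁻¹≈ε⇒x≈y δ 1# δ-1≈0))

      t≤r⇒as≈0 : t ≤ r → a * s ≈ 0#
      t≤r⇒as≈0 t≤r = x*y≈0⇒y≈0 δ-1≉0 (begin
        (δ - 1#) * (a * s)  ≈⟨ solve 3 (λ δ a s → (δ :- con (+ 1)) :* (a :* s) := a :* ((δ :- con (+ 1)) :* s)) ≈-refl δ a s ⟩
        a * t               ≈⟨ antisym (≤-respʳ-≈ ar≈0 (*-monoʳ-≤-nonneg 0≤a t≤r)) 0≤at ⟩
        0#                  ∎)
        where
        open ≈-Reasoning
        0≤at : 0# ≤ a * t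
        0≤at = *-nonneg 0≤a (*-nonneg (x≤y⇒0≤y-x (proj₁ 1<δ)) 0≤s)

      as≈0⇒aa≈a : a * s ≈ 0# → a * a ≈ a
      as≈0⇒aa≈a as≈0 = begin
        a * a
          ≈⟨ solve 3 (λ δ a s → a :* a := (a :* ((a :+ δ :* s) :- con (+ 1)) :- δ :* (a :* s)) :+ a) ≈-refl δ a s ⟩
        ((a * r) - (δ * (a * s))) + a ≈⟨ +-congʳ (+-cong ar≈0 (-‿cong (*-congˡ as≈0))) ⟩
        (0# - (δ * 0#)) + a           ≈⟨ solve 2 (λ δ a → (con (+ 0) :- δ :* con (+ 0)) :+ a := a) ≈-refl δ a ⟩
        a                             ∎
        where open ≈-Reasoning

      as≈0⇒a≈1⇒a+s≈1 : a * s ≈ 0# → a ≈ 1# → a + s ≈ 1#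
      as≈0⇒a≈1⇒a+s≈1 as≈0 a≈1 = begin
        a + s        ≈⟨ +-congʳ a≈1 ⟩
        1# + s       ≈⟨ +-congˡ (*-identityˡ s) ⟨
        1# + 1# * s  ≈⟨ +-congˡ (*-congʳ a≈1) ⟨
        1# + a * s   ≈⟨ +-congˡ as≈0 ⟩
        1# + 0#      ≈⟨ +-identityʳ 1# ⟩
        1#           ∎
        where open ≈-Reasoning

    complementarity-dichotomy : a + s ≤ 1# ⊎ a ≈ 0#
    complementarity-dichotomy with total r t
    ... | inj₁ r≤t = inj₁ (r≤t⇒a+s≤1 r≤t)
    ... | inj₂ t≤r with idempotent⇒≈0⊎≈1 (as≈0⇒aa≈a (t≤r⇒as≈0 t≤r))
    ...   | inj₁ a≈0 = inj₂ a≈0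
    ...   | inj₂ a≈1 = inj₁ (≈⇒≤ (as≈0⇒a≈1⇒a+s≈1 (t≤r⇒as≈0 t≤r) a≈1))

module Subsets where

  Subset : ℕ → Set
  Subset n = Fin n → Bool

  module _ {n : ℕ} where

    infix 4 _∈_ _∉_ _⊆_
    infixr 7 _∩_
    infixr 6 _∪_ _∖_

    _∈_ _∉_ : Fin n → Subset n → Set
    i ∈ S = S i ≡ true
    i ∉ S = S i ≡ false

    _⊆_ : Subset n → Subset n → Set
    S ⊆ T = ∀ i → i ∈ S → i ∈ T

    ∅ : Subset n
    ∅ _ = false

    ｛_｝ : Fin n → Subset n
    ｛ u ｝ i = does (i ≟ u)

    _∩_ _∪_ _∖_ : Subset n → Subset n → Subset n
    (S ∩ T) i = S i ∧ T i
    (S ∪ T) i = S i ∨ T i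
    (S ∖ T) i = not (T i) ∧ S i

    ∁ : Subset n → Subset n
    ∁ S i = not (S i)

    u∈｛u｝ : ∀ u → u ∈ ｛ u ｝
    u∈｛u｝ u = dec-true (u ≟ u) ≡.refl

    ∈-∖⁻ : ∀ {S T} i → i ∈ S ∖ T → i ∈ S × i ∉ T
    ∈-∖⁻ {S} {T} i i∈S∖T with S i | T i
    ... | true | false = ≡.refl , ≡.refl

    ∈-∪⁺ˡ : ∀ {S T} i → i ∈ S → i ∈ S ∪ T
    ∈-∪⁺ˡ {S} i i∈S rewrite i∈S = ≡.refl

    ∈-∪⁺ʳ : ∀ {S T} i → i ∈ T → i ∈ S ∪ T
    ∈-∪⁺ʳ {S} i i∈T rewrite i∈T = ∨-zeroʳ (S i)

    ∈-or-∉ : ∀ S i → i ∈ S ⊎ i ∉ S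
    ∈-or-∉ S i with S i
    ... | true  = inj₁ ≡.refl
    ... | false = inj₂ ≡.refl

    ∈⇒¬∉ : ∀ {S} i → i ∈ S → ¬ (i ∉ S)
    ∈⇒¬∉ i i∈S i∉S with ≡.trans (≡.sym i∈S) i∉S
    ... | ()

    ⊆-trans : ∀ {S T U} → S ⊆ T → T ⊆ U → S ⊆ U
    ⊆-trans S⊆T T⊆U i i∈S = T⊆U i (S⊆T i i∈S)

    ⊆-∉ : ∀ {S T} i → S ⊆ T → i ∉ T → i ∉ S
    ⊆-∉ {S} {T} i S⊆T i∉T with S i in i∈S
    ... | true  = ⊥-elim (∈⇒¬∉ {T} i (S⊆T i i∈S) i∉T)
    ... | false = ≡.refl

    ｛｝-⊆ : ∀ {T u} → u ∈ T → ｛ u ｝ ⊆ T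
    ｛｝-⊆ {u = u} u∈T i i∈｛u｝ with i ≟ u
    ... | yes ≡.refl = u∈T

    ∪-⊆ : ∀ {S T U} → S ⊆ U → T ⊆ U → S ∪ T ⊆ U
    ∪-⊆ {S} S⊆U T⊆U i i∈S∪T with S i in i∈S
    ... | true  = S⊆U i i∈S
    ... | false = T⊆U i i∈S∪T

    ∖-⊆ : ∀ S T → S ∖ T ⊆ S
    ∖-⊆ S T i i∈S∖T = proj₁ (∈-∖⁻ {S} {T} i i∈S∖T)

    u∉S∖｛u｝ : ∀ S u → u ∉ S ∖ ｛ u ｝
    u∉S∖｛u｝ S u rewrite u∈｛u｝ u = ≡.refl

    ∁-⊆ : ∀ {S T} → S ⊆ T → ∁ T ⊆ ∁ S
    ∁-⊆ {S} {T} S⊆T i i∈∁T with S i in i∈S | T i in i∈T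
    ... | true  | true  = ⊥-elim (∈⇒¬∉ i i∈∁T ≡.refl)
    ... | true  | false = ⊥-elim (∈⇒¬∉ {T} i (S⊆T i i∈S) i∈T)
    ... | false | _     = ≡.refl

    ∉⇒∈∁ : ∀ {S} i → i ∉ S → i ∈ ∁ S
    ∉⇒∈∁ i i∉S rewrite i∉S = ≡.refl

    ∈⇒∉∁ : ∀ {S} i → i ∈ S → i ∉ ∁ S
    ∈⇒∉∁ i i∈S rewrite i∈S = ≡.refl

    ∩-｛｝ : ∀ {T u} → u ∈ T → T ∩ ｛ u ｝ ≗ ｛ u ｝
    ∩-｛｝ {T} {u} u∈T i with i ≟ u
    ... | yes ≡.refl rewrite u∈T = ≡.refl
    ... | no _ = ∧-zeroʳ (T i)

    ｛｝∪-∖-｛｝ : ∀ {S u} → u ∉ S → (｛ u ｝ ∪ S) ∖ ｛ u ｝ ≗ S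
    ｛｝∪-∖-｛｝ {S} {u} u∉S i with i ≟ u
    ... | yes ≡.refl = ≡.sym u∉S
    ... | no _ = ≡.refl

  subsets : ∀ n → List (Subset n)
  subsets zero    = (λ ()) ∷ []
  subsets (suc n) = map (true Vec.∷_) (subsets n) ++ map (false Vec.∷_) (subsets n)

  subsets-complete : ∀ {n} (S : Subset n) → Σ (Subset n) λ T → T ∈ₗ subsets n × S ≗ T
  subsets-complete {zero}  S = (λ ()) , here ≡.refl , λ ()
  subsets-complete {suc n} S with subsets-complete (tail S) | S fzero in S₀
  ... | T , T∈ , tailS≗T | true  = true Vec.∷ T , ∈-++⁺ˡ (∈-map⁺ (true Vec.∷_) T∈) ,
                                   λ { fzero → S₀ ; (fsuc i) → tailS≗T i }
  ... | T , T∈ , tailS≗T | false = false Vec.∷ T , ∈-++⁺ʳ _ (∈-map⁺ (false Vec.∷_) T∈) ,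
                                   λ { fzero → S₀ ; (fsuc i) → tailS≗T i }

  size : ∀ {n} → Subset n → ℕ
  size {zero}  S = 0
  size {suc n} S = (if S fzero then 1 else 0) ℕ.+ size (tail S)

  private
    if-1-0-mono : ∀ {a b} → (a ≡ true → b ≡ true) → (if a then 1 else 0) ℕ.≤ (if b then 1 else 0)
    if-1-0-mono {false}        _   = z≤n
    if-1-0-mono {true} {true}  _   = ℕₚ.≤-refl
    if-1-0-mono {true} {false} a⇒b with a⇒b ≡.refl
    ... | ()

  size-mono : ∀ {n} {S T : Subset n} → S ⊆ T → size S ℕ.≤ size T
  size-mono {zero}  _   = z≤n
  size-mono {suc n} S⊆T = ℕₚ.+-mono-≤ (if-1-0-mono (S⊆T fzero)) (size-mono (λ i → S⊆T (fsuc i)))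

  size-strict : ∀ {n} {S T : Subset n} {u} → S ⊆ T → u ∉ S → u ∈ T → size S ℕ.< size T
  size-strict {suc n} {S} {T} {fzero} S⊆T u∉S u∈T rewrite u∉S | u∈T =
    s≤s (size-mono (λ i → S⊆T (fsuc i)))
  size-strict {suc n} {u = fsuc u} S⊆T u∉S u∈T =
    ℕₚ.+-mono-≤-< (if-1-0-mono (S⊆T fzero)) (size-strict (λ i → S⊆T (fsuc i)) u∉S u∈T)

module FiniteMaximisation {c ℓ₁ ℓ₂} (O : TotalOrder c ℓ₁ ℓ₂) where
  open TotalOrder O
  open Subsets
  open import Data.List.Extrema O using (argmax; argmax-all; f[⊥]≤f[argmax]; f[xs]≤f[argmax])

  argmax-filter : ∀ {a p} {A : Set a} {P : A → Set p} (P? : Decidable P) (f : A → Carrier) xs →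
                  (∀ x → x ∈ₗ xs → ¬ P x) ⊎ Σ A λ m → P m × (∀ x → x ∈ₗ xs → P x → f x ≤ f m)
  argmax-filter P? f xs with filter P? xs in eq | all-filter P? xs
  ... | []     | _         = inj₁ λ x x∈xs Px → ¬Any[] (≡.subst (x ∈ₗ_) eq (∈-filter⁺ P? x∈xs Px))
  ... | y ∷ ys | Py ∷ Pys  = inj₂ (argmax f y ys , argmax-all f Py Pys ,
                                  λ x x∈xs Px → bound (≡.subst (x ∈ₗ_) eq (∈-filter⁺ P? x∈xs Px)))
    where
    bound : ∀ {x} → x ∈ₗ y ∷ ys → f x ≤ f (argmax f y ys)
    bound (here ≡.refl) = f[⊥]≤f[argmax] {f = f} y ys
    bound (there x∈ys)  = All.lookup (f[xs]≤f[argmax] {f = f} y ys) x∈ys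

  maximum-element : ∀ {n} (f : Fin n → Carrier) (T : Subset n) →
                    (∀ i → i ∉ T) ⊎ Σ (Fin n) λ u → u ∈ T × (∀ i → i ∈ T → f i ≤ f u)
  maximum-element f T with argmax-filter (λ i → T i Bool.≟ true) f (allFin _)
  ... | inj₁ none              = inj₁ λ i → ¬-not (none i (∈-allFin i))
  ... | inj₂ (u , u∈T , max)   = inj₂ (u , u∈T , λ i → max i (∈-allFin i))

  maximum-subset : ∀ {n p} {P : Subset n → Set p} → Decidable P → (∀ {S T} → S ≗ T → P S → P T) →
                   (f : Subset n → Carrier) → (∀ {S T} → S ≗ T → f S ≈ f T) →
                   ∀ {S₀} → P S₀ → Σ (Subset n) λ S → P S × (∀ T → P T → f T ≤ f S)
  maximum-subset {n} {P = P} P? P-resp f f-resp {S₀} PS₀ with argmax-filter P? f (subsets n)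
  ... | inj₁ none with subsets-complete S₀
  ...   | T , T∈ , S₀≗T = ⊥-elim (none T T∈ (P-resp S₀≗T PS₀))
  maximum-subset {n} {P = P} P? P-resp f f-resp PS₀ | inj₂ (S , PS , max) = S , PS , bound
    where
    bound : ∀ T → P T → f T ≤ f S
    bound T PT with subsets-complete T
    ... | T′ , T′∈ , T≗T′ = ≤-respˡ-≈ (Eq.sym (f-resp T≗T′)) (max T′ T′∈ (P-resp T≗T′ PT))

module IndependentSets {n : ℕ} (G : Graph n) where
  open Graph G
  open Subsets

  -- For an independent set, being dominating is the same as being maximal.
  Dominating : Subset n → Set
  Dominating S = ∀ i → i ∉ S → Σ (Fin n) λ j → j ∈ S × adj i j ≡ true

  independent? : Decidable (Independent G)
  independent? S = all? λ i → all? λ j →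
    (S i Bool.≟ true) →-dec (S j Bool.≟ true) →-dec (adj i j Bool.≟ false)

  independent-resp : ∀ {S T} → S ≗ T → Independent G S → Independent G T
  independent-resp S≗T ind i j i∈T j∈T = ind i j (≡.trans (S≗T i) i∈T) (≡.trans (S≗T j) j∈T)

  independent-insert : ∀ {S u} → Independent G S → (∀ j → j ∈ S → adj u j ≡ false) →
                       Independent G (｛ u ｝ ∪ S)
  independent-insert {S} {u} ind u≁S i j i∈ j∈ with i ≟ u | j ≟ u
  ... | yes ≡.refl | yes ≡.refl = irrefl u
  ... | yes ≡.refl | no _       = u≁S j j∈
  ... | no _       | yes ≡.refl = ≡.trans (symm i u) (u≁S i i∈)
  ... | no _       | no _       = ind i j i∈ j∈

  extend-to-dominating : ∀ {S} → Independent G S →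
                         Σ (Subset n) λ S⁺ → Independent G S⁺ × S ⊆ S⁺ × Dominating S⁺
  extend-to-dominating {S} ind = extend S ind (<-wellFounded (size (∁ S)))
    where
    has-neighbour-in? : ∀ S u → Dec (Σ (Fin n) λ j → j ∈ S × adj u j ≡ true)
    has-neighbour-in? S u = any? λ j → (S j Bool.≟ true) ×-dec (adj u j Bool.≟ true)

    extend : ∀ S → Independent G S → Acc ℕ._<_ (size (∁ S)) →
             Σ (Subset n) λ S⁺ → Independent G S⁺ × S ⊆ S⁺ × Dominating S⁺
    extend S ind (acc smaller) with any? (λ u → (S u Bool.≟ false) ×-dec ¬? (has-neighbour-in? S u))
    ... | no no-candidate = S , ind , (λ _ i∈S → i∈S) , dominating
      where
      dominating : Dominating S
      dominating i i∉S with has-neighbour-in? S i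
      ... | yes neighbour = neighbour
      ... | no ¬neighbour = ⊥-elim (no-candidate (i , i∉S , ¬neighbour))
    ... | yes (u , u∉S , ¬neighbour) =
      shrink (extend (｛ u ｝ ∪ S) (independent-insert ind u≁S) (smaller ∁-shrinks))
      where
      u≁S : ∀ j → j ∈ S → adj u j ≡ false
      u≁S j j∈S = ¬-not λ u~j → ¬neighbour (j , j∈S , u~j)

      S⊆u∪S : S ⊆ ｛ u ｝ ∪ S
      S⊆u∪S i = ∈-∪⁺ʳ {S = ｛ u ｝} {T = S} i

      ∁-shrinks : size (∁ (｛ u ｝ ∪ S)) ℕ.< size (∁ S)
      ∁-shrinks = size-strict (∁-⊆ S⊆u∪S) (∈⇒∉∁ {S = ｛ u ｝ ∪ S} u (∈-∪⁺ˡ {S = ｛ u ｝} {T = S} u (u∈｛u｝ u)))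
                              (∉⇒∈∁ {S = S} u u∉S)

      shrink : Σ (Subset n) (λ S⁺ → Independent G S⁺ × ｛ u ｝ ∪ S ⊆ S⁺ × Dominating S⁺) →
               Σ (Subset n) (λ S⁺ → Independent G S⁺ × S ⊆ S⁺ × Dominating S⁺)
      shrink (S⁺ , ind⁺ , ⊆S⁺ , dom⁺) = S⁺ , ind⁺ , ⊆-trans S⊆u∪S ⊆S⁺ , dom⁺

module FiniteSums {c ℓ₁ ℓ₂} (F : OrderedField c ℓ₁ ℓ₂) where
  open OrderedFieldProperties F
  open Subsets

  sumF-cong : ∀ {n} {f g : Fin n → Carrier} → (∀ i → f i ≈ g i) → sumF F f ≈ sumF F g
  sumF-cong {zero}  f≈g = ≈-refl
  sumF-cong {suc n} f≈g = +-cong (f≈g fzero) (sumF-cong (λ i → f≈g (fsuc i)))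

  sumF-mono : ∀ {n} {f g : Fin n → Carrier} → (∀ i → f i ≤ g i) → sumF F f ≤ sumF F g
  sumF-mono {zero}  f≤g = ≤-refl
  sumF-mono {suc n} f≤g = +-mono-≤ (f≤g fzero) (sumF-mono (λ i → f≤g (fsuc i)))

  sumF-0 : ∀ {n} → sumF F {n} (λ _ → 0#) ≈ 0#
  sumF-0 {zero}  = ≈-refl
  sumF-0 {suc n} = ≈-trans (+-identityˡ _) (sumF-0 {n})

  sumF-zero : ∀ {n} {f : Fin n → Carrier} → (∀ i → f i ≈ 0#) → sumF F f ≈ 0#
  sumF-zero {n} f≈0 = ≈-trans (sumF-cong f≈0) (sumF-0 {n})

  sumF-distrib-+ : ∀ {n} (f g : Fin n → Carrier) → sumF F (λ i → f i + g i) ≈ sumF F f + sumF F g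
  sumF-distrib-+ {zero}  f g = ≈-sym (+-identityˡ 0#)
  sumF-distrib-+ {suc n} f g = begin
    (f fzero + g fzero) + sumF F (λ i → f (fsuc i) + g (fsuc i))
      ≈⟨ +-congˡ (sumF-distrib-+ (tail f) (tail g)) ⟩
    (f fzero + g fzero) + (sumF F (tail f) + sumF F (tail g))
      ≈⟨ solve 4 (λ a b c d → (a :+ b) :+ (c :+ d) := (a :+ c) :+ (b :+ d)) ≈-refl _ _ _ _ ⟩
    (f fzero + sumF F (tail f)) + (g fzero + sumF F (tail g))
      ∎
    where open ≈-Reasoning

  sumF-distribˡ-* : ∀ {n} k (f : Fin n → Carrier) → sumF F (λ i → k * f i) ≈ k * sumF F f
  sumF-distribˡ-* {zero}  k f = ≈-sym (zeroʳ k)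
  sumF-distribˡ-* {suc n} k f = begin
    k * f fzero + sumF F (λ i → k * f (fsuc i))  ≈⟨ +-congˡ (sumF-distribˡ-* k (tail f)) ⟩
    k * f fzero + k * sumF F (tail f)            ≈⟨ distribˡ k (f fzero) (sumF F (tail f)) ⟨
    k * (f fzero + sumF F (tail f))              ∎
    where open ≈-Reasoning

  sumF-nonneg : ∀ {n} {f : Fin n → Carrier} → (∀ i → 0# ≤ f i) → 0# ≤ sumF F f
  sumF-nonneg {n} 0≤f = ≤-respˡ-≈ (sumF-0 {n}) (sumF-mono 0≤f)

  term≤sumF : ∀ {n} {f : Fin n → Carrier} → (∀ i → 0# ≤ f i) → ∀ u → f u ≤ sumF F f
  term≤sumF {suc n} {f} 0≤f fzero = begin
    f fzero                      ≈⟨ +-identityʳ (f fzero) ⟨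
    f fzero + 0#                 ≤⟨ +-monoʳ-≤ (f fzero) (sumF-nonneg (λ i → 0≤f (fsuc i))) ⟩
    f fzero + sumF F (tail f)    ∎
    where open ≤-Reasoning
  term≤sumF {suc n} {f} 0≤f (fsuc u) = begin
    f (fsuc u)                   ≈⟨ +-identityˡ (f (fsuc u)) ⟨
    0# + f (fsuc u)              ≤⟨ +-mono-≤ (0≤f fzero) (term≤sumF (λ i → 0≤f (fsuc i)) u) ⟩
    f fzero + sumF F (tail f)    ∎
    where open ≤-Reasoning

  sumF≈0⇒term≈0 : ∀ {n} {f : Fin n → Carrier} → (∀ i → 0# ≤ f i) → sumF F f ≈ 0# → ∀ u → f u ≈ 0#
  sumF≈0⇒term≈0 0≤f Σf≈0 u = antisym (≤-respʳ-≈ Σf≈0 (term≤sumF 0≤f u)) (0≤f u)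

  sumOver : ∀ {n} → Subset n → (Fin n → Carrier) → Carrier
  sumOver S f = sumF F (λ i → if S i then f i else 0#)

  sumOver-cong : ∀ {n} {S T : Subset n} f → S ≗ T → sumOver S f ≈ sumOver T f
  sumOver-cong f S≗T = sumF-cong (λ i → ≡⇒≈ (≡.cong (λ b → if b then f i else 0#) (S≗T i)))

  sumOver-⊆ : ∀ {n} {S T : Subset n} {f} → (∀ i → 0# ≤ f i) → S ⊆ T → sumOver S f ≤ sumOver T f
  sumOver-⊆ {S = S} {T} {f} 0≤f S⊆T = sumF-mono pointwise
    where
    pointwise : ∀ i → (if S i then f i else 0#) ≤ (if T i then f i else 0#)
    pointwise i with S i in i∈S | T i in i∈T
    ... | true  | true  = ≤-refl
    ... | true  | false with ≡.trans (≡.sym (S⊆T i i∈S)) i∈T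
    ...   | ()
    pointwise i | false | true  = 0≤f i
    pointwise i | false | false = ≤-refl

  sumOver-split : ∀ {n} (T P : Subset n) f → sumOver T f ≈ sumOver (T ∩ P) f + sumOver (T ∖ P) f
  sumOver-split {n} T P f = ≈-trans (sumF-cong pointwise) (sumF-distrib-+ {n} _ _)
    where
    pointwise : ∀ i → (if T i then f i else 0#) ≈
                      (if T i ∧ P i then f i else 0#) + (if not (P i) ∧ T i then f i else 0#)
    pointwise i with T i | P i
    ... | true  | true  = ≈-sym (+-identityʳ (f i))
    ... | true  | false = ≈-sym (+-identityˡ (f i))
    ... | false | true  = ≈-sym (+-identityˡ 0#)
    ... | false | false = ≈-sym (+-identityˡ 0#)

  sumOver-｛｝ : ∀ {n} u (f : Fin n → Carrier) → sumOver ｛ u ｝ f ≈ f u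
  sumOver-｛｝ {suc n} fzero    f = ≈-trans (+-congˡ (sumF-0 {n})) (+-identityʳ (f fzero))
  sumOver-｛｝ {suc n} (fsuc u) f = ≈-trans (+-identityˡ _) (sumOver-｛｝ u (tail f))

  sumOver-remove : ∀ {n} {T : Subset n} {u} f → u ∈ T → sumOver T f ≈ sumOver (T ∖ ｛ u ｝) f + f u
  sumOver-remove {T = T} {u} f u∈T = begin
    sumOver T f                                         ≈⟨ sumOver-split T ｛ u ｝ f ⟩
    sumOver (T ∩ ｛ u ｝) f + sumOver (T ∖ ｛ u ｝) f    ≈⟨ +-congʳ (sumOver-cong f (∩-｛｝ u∈T)) ⟩
    sumOver ｛ u ｝ f + sumOver (T ∖ ｛ u ｝) f          ≈⟨ +-congʳ (sumOver-｛｝ u f) ⟩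
    f u + sumOver (T ∖ ｛ u ｝) f                        ≈⟨ +-comm (f u) (sumOver (T ∖ ｛ u ｝) f) ⟩
    sumOver (T ∖ ｛ u ｝) f + f u                        ∎
    where open ≈-Reasoning

  sumOver-insert : ∀ {n} {S : Subset n} {u} f → u ∉ S → sumOver (｛ u ｝ ∪ S) f ≈ sumOver S f + f u
  sumOver-insert {S = S} {u} f u∉S = ≈-trans (sumOver-remove f (∈-∪⁺ˡ {S = ｛ u ｝} {T = S} u (u∈｛u｝ u)))
                                          (+-congʳ (sumOver-cong f (｛｝∪-∖-｛｝ u∉S)))

module LCPSolutions {c ℓ₁ ℓ₂} (F : OrderedField c ℓ₁ ℓ₂) {n : ℕ} (G : Graph n) where
  open OrderedFieldProperties F
  open FiniteSums F
  open Subsets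
  open IndependentSets G
  open FiniteMaximisation totalOrder using (maximum-element; maximum-subset)
  open Graph G

  indicator : Subset n → Fin n → Carrier
  indicator S i = if S i then 1# else 0#

  neighbourSum : (Fin n → Carrier) → Fin n → Carrier
  neighbourSum x i = sumF F (λ j → adjMat F G i j * x j)

  indicator-∉ : ∀ {S i} → i ∉ S → indicator S i ≈ 0#
  indicator-∉ i∉S = ≡⇒≈ (≡.cong (λ b → if b then 1# else 0#) i∉S)

  0≤if-1-0 : ∀ b → 0# ≤ (if b then 1# else 0#)
  0≤if-1-0 true  = 0≤1
  0≤if-1-0 false = ≤-refl

  0≤neighbourSum : ∀ {x} → (∀ i → 0# ≤ x i) → ∀ i → 0# ≤ neighbourSum x i
  0≤neighbourSum 0≤x i = sumF-nonneg λ j → *-nonneg (0≤if-1-0 (adj i j)) (0≤x j)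

  dot-indicator : ∀ w S → dot F w (indicator S) ≈ weightOf F w S
  dot-indicator w S = sumF-cong pointwise
    where
    pointwise : ∀ i → w i * indicator S i ≈ (if S i then w i else 0#)
    pointwise i with S i
    ... | true  = *-identityʳ (w i)
    ... | false = zeroʳ (w i)

  neighbourSum-indicator-∈ : ∀ {S i} → Independent G S → i ∈ S → neighbourSum (indicator S) i ≈ 0#
  neighbourSum-indicator-∈ {S} {i} ind i∈S = sumF-zero pointwise
    where
    pointwise : ∀ j → adjMat F G i j * indicator S j ≈ 0#
    pointwise j with adj i j in i~j | S j in j∈S
    ... | true  | true  with ≡.trans (≡.sym i~j) (ind i j i∈S j∈S)
    ...   | ()
    pointwise j | true  | false = zeroʳ 1#
    pointwise j | false | _     = zeroˡ _

  1≤neighbourSum-indicator-∉ : ∀ {S i} → Dominating S → i ∉ S → 1# ≤ neighbourSum (indicator S) i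
  1≤neighbourSum-indicator-∉ {S} {i} dom i∉S with dom i i∉S
  ... | j , j∈S , i~j = begin
    1#                                 ≈⟨ *-identityʳ 1# ⟨
    1# * 1#                            ≈⟨ ≡⇒≈ (≡.cong₂ (λ a b → (if a then 1# else 0#) * (if b then 1# else 0#)) i~j j∈S) ⟨
    adjMat F G i j * indicator S j     ≤⟨ term≤sumF (λ k → *-nonneg (0≤if-1-0 (adj i k)) (0≤if-1-0 (S k))) j ⟩
    neighbourSum (indicator S) i       ∎
    where open ≤-Reasoning

  dominating-independent-solvesLCP : ∀ {S δ} → Independent G S → Dominating S → 1# ≤ δ →
                                   SolvesLCP F G δ (indicator S)
  dominating-independent-solvesLCP {S} {δ} ind dom 1≤δ =
    (λ i → 0≤if-1-0 (S i)) , 0≤residual , sumF-zero complementary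
    where
    residual-∈ : ∀ {i} → i ∈ S → lcpResidual F G δ (indicator S) i ≈ 0#
    residual-∈ {i} i∈S rewrite i∈S = begin
      (1# + δ * neighbourSum (indicator S) i) - 1#  ≈⟨ +-congʳ (+-congˡ (*-congˡ (neighbourSum-indicator-∈ ind i∈S))) ⟩
      (1# + δ * 0#) - 1#
        ≈⟨ solve 1 (λ δ → (con (+ 1) :+ δ :* con (+ 0)) :- con (+ 1) := con (+ 0)) ≈-refl δ ⟩
      0#                                           ∎
      where open ≈-Reasoning
    0≤residual-∉ : ∀ {i} → i ∉ S → 0# ≤ lcpResidual F G δ (indicator S) i
    0≤residual-∉ {i} i∉S rewrite i∉S = x≤y⇒0≤y-x (begin
      1#                                      ≤⟨ 1≤δ ⟩
      δ                                       ≈⟨ *-identityʳ δ ⟨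
      δ * 1#                                  ≤⟨ *-monoʳ-≤-nonneg (≤-trans 0≤1 1≤δ) (1≤neighbourSum-indicator-∉ dom i∉S) ⟩
      δ * neighbourSum (indicator S) i        ≈⟨ +-identityˡ _ ⟨
      0# + δ * neighbourSum (indicator S) i   ∎)
      where open ≤-Reasoning
    0≤residual : ∀ i → 0# ≤ lcpResidual F G δ (indicator S) i
    0≤residual i = [ (λ i∈S → ≈⇒≤ (≈-sym (residual-∈ i∈S))) , 0≤residual-∉ ]′ (∈-or-∉ S i)
    complementary : ∀ i → indicator S i * lcpResidual F G δ (indicator S) i ≈ 0#
    complementary i = [ (λ i∈S → ≈-trans (*-congˡ (residual-∈ i∈S)) (zeroʳ _))
                      , (λ i∉S → ≈-trans (*-congʳ (indicator-∉ {S} {i} i∉S)) (zeroˡ _)) ]′ (∈-or-∉ S i)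

  neighbours-bound : ∀ {w x : Fin n → Carrier} → (∀ i → 0# ≤ w i) → (∀ i → 0# ≤ x i) →
                     ∀ T u → (∀ i → i ∈ T → w i ≤ w u) →
                     sumOver (T ∩ adj u) (λ i → w i * x i) ≤ w u * neighbourSum x u
  neighbours-bound {w} {x} 0≤w 0≤x T u u-max = begin
    sumOver (T ∩ adj u) (λ i → w i * x i)        ≤⟨ sumF-mono pointwise ⟩
    sumF F (λ i → w u * (adjMat F G u i * x i))  ≈⟨ sumF-distribˡ-* (w u) (λ i → adjMat F G u i * x i) ⟩
    w u * neighbourSum x u                       ∎
    where
    open ≤-Reasoning
    pointwise : ∀ i → (if T i ∧ adj u i then w i * x i else 0#) ≤ w u * (adjMat F G u i * x i)
    pointwise i with T i in i∈T | adj u i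
    ... | true  | true  = begin
      w i * x i         ≤⟨ *-monoˡ-≤-nonneg (0≤x i) (u-max i i∈T) ⟩
      w u * x i         ≈⟨ *-congˡ (*-identityˡ (x i)) ⟨
      w u * (1# * x i)  ∎
    ... | true  | false = *-nonneg (0≤w u) (*-nonneg ≤-refl (0≤x i))
    ... | false | u~i   = *-nonneg (0≤w u) (*-nonneg (0≤if-1-0 u~i) (0≤x i))

  module _ {w : Fin n → Carrier} (0≤w : ∀ i → 0# ≤ w i) {δ} (1<δ : 1# < δ)
           {x : Fin n → Carrier} (x-solves : SolvesLCP F G δ x) where

    private
      0≤x : ∀ i → 0# ≤ x i
      0≤x = proj₁ x-solves

      0≤residual : ∀ i → 0# ≤ lcpResidual F G δ x i
      0≤residual = proj₁ (proj₂ x-solves)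

      complementary : sumF F (λ i → x i * lcpResidual F G δ x i) ≈ 0#
      complementary = proj₂ (proj₂ x-solves)

      wx : Fin n → Carrier
      wx i = w i * x i

    vertex-dichotomy : ∀ u → x u + neighbourSum x u ≤ 1# ⊎ x u ≈ 0#
    vertex-dichotomy u = complementarity-dichotomy 1<δ (0≤x u) (0≤neighbourSum 0≤x u)
      (sumF≈0⇒term≈0 (λ i → *-nonneg (0≤x i) (0≤residual i)) complementary u)

    IndependentBound : Subset n → Set ℓ₂
    IndependentBound T = Σ (Subset n) λ S → Independent G S × S ⊆ T × sumOver T wx ≤ weightOf F w S

    independent-bound : ∀ T → Acc ℕ._<_ (size T) → IndependentBound T
    independent-bound T (acc smaller) with maximum-element w T
    ... | inj₁ T-empty = ∅ , (λ _ _ ()) , (λ _ ()) , ≈⇒≤ (sumOver-cong wx T-empty)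
    ... | inj₂ (u , u∈T , u-max) with vertex-dichotomy u
    ...   | inj₂ xu≈0 =
      drop (independent-bound (T ∖ ｛ u ｝) (smaller (size-strict (∖-⊆ T ｛ u ｝) (u∉S∖｛u｝ T u) u∈T)))
      where
      drop : IndependentBound (T ∖ ｛ u ｝) → IndependentBound T
      drop (S , ind , S⊆ , bound) = S , ind , ⊆-trans S⊆ (∖-⊆ T ｛ u ｝) , (begin
        sumOver T wx                         ≈⟨ sumOver-remove wx u∈T ⟩
        sumOver (T ∖ ｛ u ｝) wx + w u * x u   ≈⟨ +-congˡ (≈-trans (*-congˡ xu≈0) (zeroʳ (w u))) ⟩
        sumOver (T ∖ ｛ u ｝) wx + 0#          ≈⟨ +-identityʳ _ ⟩
        sumOver (T ∖ ｛ u ｝) wx               ≤⟨ bound ⟩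
        weightOf F w S                       ∎)
        where open ≤-Reasoning
    ...   | inj₁ xu+s≤1 = take (independent-bound R (smaller (size-strict R⊆T u∉R u∈T)))
      where
      R : Subset n
      R = (T ∖ ｛ u ｝) ∖ adj u
      R⊆T : R ⊆ T
      R⊆T = ⊆-trans (∖-⊆ (T ∖ ｛ u ｝) (adj u)) (∖-⊆ T ｛ u ｝)
      u∉R : u ∉ R
      u∉R = ⊆-∉ u (∖-⊆ (T ∖ ｛ u ｝) (adj u)) (u∉S∖｛u｝ T u)
      take : IndependentBound R → IndependentBound T
      take (S , ind , S⊆R , bound) =
        ｛ u ｝ ∪ S , independent-insert ind u≁S , ∪-⊆ (｛｝-⊆ u∈T) (⊆-trans S⊆R R⊆T) , (begin
        sumOver T wx                                                  ≈⟨ sumOver-remove wx u∈T ⟩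
        sumOver (T ∖ ｛ u ｝) wx + wx u                                 ≈⟨ +-congʳ (sumOver-split (T ∖ ｛ u ｝) (adj u) wx) ⟩
        (sumOver ((T ∖ ｛ u ｝) ∩ adj u) wx + sumOver R wx) + wx u      ≤⟨ +-monoˡ-≤ (wx u) (+-mono-≤ neighbours bound) ⟩
        (w u * s + weightOf F w S) + w u * x u
          ≈⟨ solve 4 (λ wu s W xu → (wu :* s :+ W) :+ wu :* xu := W :+ wu :* (xu :+ s)) ≈-refl (w u) s (weightOf F w S) (x u) ⟩
        weightOf F w S + w u * (x u + s)                              ≤⟨ +-monoʳ-≤ _ (*-monoʳ-≤-nonneg (0≤w u) xu+s≤1) ⟩
        weightOf F w S + w u * 1#                                     ≈⟨ +-congˡ (*-identityʳ (w u)) ⟩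
        weightOf F w S + w u                                          ≈⟨ sumOver-insert w (⊆-∉ {S = S} u S⊆R u∉R) ⟨
        weightOf F w (｛ u ｝ ∪ S)                                      ∎)
        where
        open ≤-Reasoning
        s : Carrier
        s = neighbourSum x u
        u≁S : ∀ j → j ∈ S → adj u j ≡ false
        u≁S j j∈S = proj₂ (∈-∖⁻ {S = T ∖ ｛ u ｝} {T = adj u} j (S⊆R j j∈S))
        neighbours : sumOver ((T ∖ ｛ u ｝) ∩ adj u) wx ≤ w u * s
        neighbours = neighbours-bound {w} {x} 0≤w 0≤x (T ∖ ｛ u ｝) u (λ i i∈ → u-max i (∖-⊆ T ｛ u ｝ i i∈))

    lcp-value≤independent-weight : Σ (Subset n) λ S → Independent G S × dot F w x ≤ weightOf F w S
    lcp-value≤independent-weight with independent-bound (λ _ → true) (<-wellFounded _)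
    ... | S , S-ind , _ , x-value≤ = S , S-ind , x-value≤

  maximum-weight-independent-set : ∀ w → Σ (Subset n) λ S →
    Independent G S × (∀ T → Independent G T → weightOf F w T ≤ weightOf F w S)
  maximum-weight-independent-set w =
    maximum-subset independent? independent-resp (weightOf F w) (sumOver-cong w) {∅} (λ _ _ ())

theorem5p1 : ∀ {c ℓ₁ ℓ₂} (F : OrderedField c ℓ₁ ℓ₂) (n : ℕ) (G : Graph n) (w : Fin n → OrderedField.Carrier F) (δ : OrderedField.Carrier F) → (∀ i → OrderedField._≤_ F (OrderedField.0# F) (w i)) → OrderedField._<_ F (OrderedField.1# F) δ → Σ (OrderedField.Carrier F) λ a → IsAlpha F G w a × IsMaximum F (SolvesLCP F G δ) (dot F w) a
theorem5p1 F n G w δ 0≤w 1<δ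
  with LCPSolutions.maximum-weight-independent-set F G w
... | S* , S*-ind , S*-max with IndependentSets.extend-to-dominating G S*-ind
... | S⁺ , S⁺-ind , S*⊆S⁺ , S⁺-dom =
  weightOf F w S* , ((S* , S*-ind , ≈-refl) , S*-max) ,
  ((indicator S⁺ , dominating-independent-solvesLCP S⁺-ind S⁺-dom (proj₁ 1<δ) , indicator-value) , lcp-value≤α)
  where
  open OrderedFieldProperties F
  open FiniteSums F
  open LCPSolutions F G

  indicator-value : dot F w (indicator S⁺) ≈ weightOf F w S*
  indicator-value = ≈-trans (dot-indicator w S⁺) (antisym (S*-max S⁺ S⁺-ind) (sumOver-⊆ 0≤w S*⊆S⁺))

  lcp-value≤α : ∀ x → SolvesLCP F G δ x → dot F w x ≤ weightOf F w S*
  lcp-value≤α x x-solves with lcp-value≤independent-weight 0≤w 1<δ x-solves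
  ... | S , S-ind , x-value≤S = ≤-trans x-value≤S (S*-max S S-ind)
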